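{- Let $d\ge 1$ and let $\psi(x_1,\ldots,x_d,k)$ be any boolean formula (built with $\wedge,\vee,\neg$) whose atomic expressions are homogeneous linear equations and inequalities (strict or weak) with rational coefficients in the variables $x_1,\ldots,x_d,k$, such that for every $k$ the set $\{x\in\mathbb{R}^d : \psi(x,k)\}$ is bounded. Then there exists a partial polytopal complex $X\subset\mathbb{R}^d$ such that for all integers $k\ge 1$, \[ \#\{x\in\mathbb{Z}^d : \psi(x,k)\} = \operatorname{ehr}_X(k). \]
   Context: A (rational) polyhedron is a set $\{x\in\mathbb{R}^d : Ax\ge b\}$ with $A,b$ integral; a polytope is a bounded polyhedron. A half-open polytope is a bounded set defined by finitely many rational linear inequalities some of which may be strict. A partial polytopal complex is any set that can be written as a finite disjoint union of half-open polytopes. For $X\subset\mathbb{R}^d$, the Ehrhart function is $\operatorname{ehr}_X(k)=\#\left(\mathbb{Z}^d\cap (k\cdot X)\right)$ for integers $k\ge 1$, where $k\cdot X=\{kx : x\in X\}$.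
   Formalization: The solution sets of ψ, the half-open polytopes and the partial polytopal complex X are taken in ℚ^d instead of ℝ^d, and k is rational in the boundedness hypothesis. -}

module Defs where

open import Data.Bool using (Bool; true; false; _∧_; _∨_; not; T)
open import Data.Nat as ℕ using (ℕ; zero; suc)
open import Data.Integer as ℤ using (ℤ; +_)
open import Data.Rational as ℚ using (ℚ; 0ℚ)
open import Data.Rational.Properties as ℚP using ()
open import Data.Fin using (Fin)
open import Data.Vec as Vec using (Vec; []; _∷_)
open import Data.List as List using (List; []; _∷_)
open import Data.Product using (Σ; _×_; ∃)
open import Relation.Nullary.Decidable using (⌊_⌋)
open import Relation.Binary.PropositionalEquality using (_≡_)
open import Data.Empty using (⊥)
open import Data.Bool.ListAction renaming (all to allᵇ; any to anyᵇ) using ()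
open import Data.Bool using (if_then_else_)
open import Data.List.Relation.Unary.AllPairs using (AllPairs)
open import Data.Vec.Relation.Unary.All renaming (All to VAll) using ()

dot : ∀ {d} → Vec ℚ d → Vec ℚ d → ℚ
dot a x = Vec.foldr _ ℚ._+_ 0ℚ (Vec.zipWith ℚ._*_ a x)

data Rel : Set where
  eq le lt ge gt : Rel

evalRel : Rel → ℚ → Bool
evalRel eq q = ⌊ q ℚP.≟ 0ℚ ⌋
evalRel le q = ⌊ q ℚP.≤? 0ℚ ⌋
evalRel lt q = ⌊ q ℚP.<? 0ℚ ⌋
evalRel ge q = ⌊ 0ℚ ℚP.≤? q ⌋
evalRel gt q = ⌊ 0ℚ ℚP.<? q ⌋

-- atom a c R  means   a₁x₁ + … + a_d x_d + c·k  R  0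
data Formula (d : ℕ) : Set where
  atom : Vec ℚ d → ℚ → Rel → Formula d
  _∧ᶠ_ : Formula d → Formula d → Formula d
  _∨ᶠ_ : Formula d → Formula d → Formula d
  ¬ᶠ_  : Formula d → Formula d

eval : ∀ {d} → Formula d → Vec ℚ d → ℚ → Bool
eval (atom a c r) x k = evalRel r (dot a x ℚ.+ c ℚ.* k)
eval (φ ∧ᶠ ψ) x k = eval φ x k ∧ eval ψ x k
eval (φ ∨ᶠ ψ) x k = eval φ x k ∨ eval ψ x k
eval (¬ᶠ φ) x k = not (eval φ x k)

Bounded : ∀ {d} → (Vec ℚ d → Bool) → Set
Bounded {d} S = Σ ℚ λ M → ∀ (x : Vec ℚ d) → T (S x) → ∀ (i : Fin d) → ℚ.∣ Vec.lookup x i ∣ ℚ.≤ M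

record Ineq (d : ℕ) : Set where
  constructor ineq
  field
    coeff  : Vec ℚ d
    rhs    : ℚ
    strict : Bool

satIneq : ∀ {d} → Ineq d → Vec ℚ d → Bool
satIneq (ineq a b false) x = ⌊ b ℚP.≤? dot a x ⌋
satIneq (ineq a b true)  x = ⌊ b ℚP.<? dot a x ⌋

memSystem : ∀ {d} → List (Ineq d) → Vec ℚ d → Bool
memSystem sys x = allᵇ (λ I → satIneq I x) sys

record HalfOpenPolytope (d : ℕ) : Set where
  constructor hop
  field
    system  : List (Ineq d)
    bounded : Bounded (memSystem system)

memHOP : ∀ {d} → HalfOpenPolytope d → Vec ℚ d → Bool
memHOP P = memSystem (HalfOpenPolytope.system P)

Disjoint : ∀ {d} → HalfOpenPolytope d → HalfOpenPolytope d → Set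
Disjoint {d} P Q = ∀ (x : Vec ℚ d) → T (memHOP P x) → T (memHOP Q x) → ⊥

record PartialPolytopalComplex (d : ℕ) : Set where
  constructor ppc
  field
    pieces   : List (HalfOpenPolytope d)
    disjoint : AllPairs Disjoint pieces

memPPC : ∀ {d} → PartialPolytopalComplex d → Vec ℚ d → Bool
memPPC X x = anyᵇ (λ P → memHOP P x) (PartialPolytopalComplex.pieces X)

-- ℤ^d point z as a rational point scaled by 1/k (k = suc n ≥ 1)
scaleDown : ∀ {d} → ℕ → Vec ℤ d → Vec ℚ d
scaleDown n z = Vec.map (λ zi → zi ℚ./ suc n) z

-- z ∈ (suc n)·X  iff  z/(suc n) ∈ X
memDilate : ∀ {d} → PartialPolytopalComplex d → ℕ → Vec ℤ d → Bool
memDilate X n z = memPPC X (scaleDown n z)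

toℚ : ∀ {d} → Vec ℤ d → Vec ℚ d
toℚ = Vec.map (λ zi → zi ℚ./ 1)

natℚ : ℕ → ℚ
natℚ n = (+ n) ℚ./ 1

range : ℕ → List ℤ
range N = List.map (λ i → (+ i) ℤ.- (+ N)) (List.upTo (suc (N ℕ.+ N)))

box : ℕ → (d : ℕ) → List (Vec ℤ d)
box N zero    = [] ∷ []
box N (suc d) = List.concatMap (λ a → List.map (a ∷_) (box N d)) (range N)

InBox : ∀ {d} → ℕ → Vec ℤ d → Set
InBox N z = VAll (λ zi → ℤ.∣ zi ∣ ℕ.≤ N) z

countTrue : ∀ {A : Set} → (A → Bool) → List A → ℕ
countTrue p [] = 0
countTrue p (a ∷ as) = (if p a then 1 else 0) ℕ.+ countTrue p as

-- #{ z ∈ ℤ^d : S z } = n   (S is a finite set: contained in some box,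
-- and its number of elements in that box is n)
HasCount : ∀ {d} → (Vec ℤ d → Bool) → ℕ → Set
HasCount {d} S n =
  Σ ℕ λ N → (∀ (z : Vec ℤ d) → T (S z) → InBox N z) × countTrue S (box N d) ≡ n

-- ehr_X(suc m) = n
EhrEq : ∀ {d} → PartialPolytopalComplex d → ℕ → ℕ → Set
EhrEq X m n = HasCount (memDilate X m) n

{-# OPTIONS --safe #-}
module Submission where

-- The sign vector of the atoms of ψ at (y, 1) is constant on cells cut out by
-- finitely many weak and strict linear inequalities, and the truth of ψ(y, 1) depends only on
-- it. The cells of the sign vectors accepted by ψ are disjoint, bounded (since {y : ψ(y, 1)}
-- is), and cover X = {y : ψ(y, 1)}. As the atoms are homogeneous, ψ(z, k) ⇔ ψ(z/k, 1) for
-- k > 0, so the lattice points of k·X are exactly the integer solutions of ψ(·, k).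

open import Defs
open import Data.Bool using (T)
open import Data.Nat using (ℕ; suc; _≤_)
open import Data.Rational using (ℚ)
open import Data.Product using (Σ; _×_)

open import Data.Bool using (Bool; true; false; _∧_; _∨_; not; if_then_else_)
open import Data.Empty using (⊥-elim)
open import Data.Unit using (tt)
open import Data.Product using (_,_; proj₁; proj₂)
open import Function using (_∘_)
import Data.Nat as ℕ
import Data.Nat.Properties as ℕP
import Data.Nat.Coprimality as Coprimality
open import Data.Integer as ℤ using (ℤ; +_; -[1+_])
import Data.Integer.Properties as ℤP
import Data.Rational as ℚ
open import Data.Rational using (mkℚ; 0ℚ; 1ℚ; 1/_; _+_; _*_; -_; _-_)
import Data.Rational.Properties as ℚP
open import Data.Rational.Solver using (module +-*-Solver)
open import Data.Vec as Vec using (Vec; []; _∷_)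
import Data.Vec.Properties as VecP
import Data.Vec.Relation.Unary.All.Properties as VecAllP
open import Data.List as List using (List; []; _∷_; _++_)
open import Data.List.Relation.Unary.All using (All; []; _∷_)
import Data.List.Relation.Unary.All.Properties as AllP
open import Data.List.Relation.Unary.Any as Any using (here; there)
import Data.List.Relation.Unary.Any.Properties as AnyP
import Data.List.Relation.Unary.AllPairs as AllPairs
import Data.List.Relation.Unary.AllPairs.Properties as AllPairsP
open import Data.List.Relation.Unary.Unique.Propositional using (Unique)
import Data.List.Relation.Unary.Unique.Propositional.Properties as UniqueP
open import Data.List.Membership.Propositional using (_∈_; lose)
open import Data.List.Membership.Propositional.Properties using (∈-cartesianProduct⁺)
open import Relation.Binary using (tri<; tri≈; tri>)
open import Relation.Binary.PropositionalEquality
open import Relation.Nullary using (¬_)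
open import Relation.Nullary.Decidable
  using (Dec; ⌊_⌋; isYes≗does; dec-true; dec-false; toWitness; fromWitness)

open +-*-Solver

isYes-true : ∀ {A : Set} (a? : Dec A) → A → ⌊ a? ⌋ ≡ true
isYes-true a? a = trans (isYes≗does a?) (dec-true a? a)

isYes-false : ∀ {A : Set} (a? : Dec A) → ¬ A → ⌊ a? ⌋ ≡ false
isYes-false a? ¬a = trans (isYes≗does a?) (dec-false a? ¬a)

T-injective : ∀ {b c} → (T b → T c) → (T c → T b) → b ≡ c
T-injective {false} {false} _   _   = refl
T-injective {false} {true}  _   c⇒b = ⊥-elim (c⇒b tt)
T-injective {true}  {false} b⇒c _   = ⊥-elim (b⇒c tt)
T-injective {true}  {true}  _   _   = refl

<⇒≱ : ∀ {p q} → p ℚ.< q → ¬ (q ℚ.≤ p)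
<⇒≱ p<q q≤p = ℚP.<-irrefl refl (ℚP.<-≤-trans p<q q≤p)

p<q⇒0<q-p : ∀ {p q} → p ℚ.< q → 0ℚ ℚ.< q - p
p<q⇒0<q-p {p} {q} p<q = subst (ℚ._< q - p) (ℚP.+-inverseʳ p) (ℚP.+-monoˡ-< (- p) p<q)

p≤q⇒0≤q-p : ∀ {p q} → p ℚ.≤ q → 0ℚ ℚ.≤ q - p
p≤q⇒0≤q-p {p} {q} p≤q = subst (ℚ._≤ q - p) (ℚP.+-inverseʳ p) (ℚP.+-monoˡ-≤ (- p) p≤q)

q-p+p≡q : ∀ p q → q - p + p ≡ q
q-p+p≡q = solve 2 (λ p q → q :- p :+ p := q) refl

0<q-p⇒p<q : ∀ {p q} → 0ℚ ℚ.< q - p → p ℚ.< q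
0<q-p⇒p<q {p} {q} 0<q-p = subst₂ ℚ._<_ (ℚP.+-identityˡ p) (q-p+p≡q p q) (ℚP.+-monoˡ-< p 0<q-p)

0≤q-p⇒p≤q : ∀ {p q} → 0ℚ ℚ.≤ q - p → p ℚ.≤ q
0≤q-p⇒p≤q {p} {q} 0≤q-p = subst₂ ℚ._≤_ (ℚP.+-identityˡ p) (q-p+p≡q p q) (ℚP.+-monoˡ-≤ p 0≤q-p)

neg-involutive : ∀ p → - (- p) ≡ p
neg-involutive = solve 1 (λ p → :- (:- p) := p) refl

0<-p⇒p<0 : ∀ {p} → 0ℚ ℚ.< - p → p ℚ.< 0ℚ
0<-p⇒p<0 {p} 0<-p = subst (ℚ._< 0ℚ) (neg-involutive p) (ℚP.neg-antimono-< 0<-p)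

0≤-p⇒p≤0 : ∀ {p} → 0ℚ ℚ.≤ - p → p ℚ.≤ 0ℚ
0≤-p⇒p≤0 {p} 0≤-p = subst (ℚ._≤ 0ℚ) (neg-involutive p) (ℚP.neg-antimono-≤ 0≤-p)

data Sign : Set where
  negative zero positive : Sign

HasSign : ℚ → Sign → Set
HasSign q negative = q ℚ.< 0ℚ
HasSign q zero     = q ≡ 0ℚ
HasSign q positive = 0ℚ ℚ.< q

sign : ℚ → Sign
sign q with ℚP.<-cmp q 0ℚ
... | tri< _ _ _ = negative
... | tri≈ _ _ _ = zero
... | tri> _ _ _ = positive

sign-correct : ∀ q → HasSign q (sign q)
sign-correct q with ℚP.<-cmp q 0ℚ
... | tri< q<0 _ _ = q<0
... | tri≈ _ q≡0 _ = q≡0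
... | tri> _ _ 0<q = 0<q

HasSign-functional : ∀ {q} σ τ → HasSign q σ → HasSign q τ → σ ≡ τ
HasSign-functional negative negative _    _    = refl
HasSign-functional negative zero     q<0  refl = ⊥-elim (ℚP.<-irrefl refl q<0)
HasSign-functional negative positive q<0  0<q  = ⊥-elim (ℚP.<-asym q<0 0<q)
HasSign-functional zero     negative refl q<0  = ⊥-elim (ℚP.<-irrefl refl q<0)
HasSign-functional zero     zero     _    _    = refl
HasSign-functional zero     positive refl 0<q  = ⊥-elim (ℚP.<-irrefl refl 0<q)
HasSign-functional positive negative 0<q  q<0  = ⊥-elim (ℚP.<-asym q<0 0<q)
HasSign-functional positive zero     0<q  refl = ⊥-elim (ℚP.<-irrefl refl 0<q)
HasSign-functional positive positive _    _    = refl

sign-unique : ∀ {q} σ → HasSign q σ → sign q ≡ σ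
sign-unique σ = HasSign-functional _ σ (sign-correct _)

HasSign-*-pos : ∀ {q} p .{{_ : ℚ.Positive p}} σ → HasSign q σ → HasSign (q * p) σ
HasSign-*-pos {q} p negative q<0  = subst (q * p ℚ.<_) (ℚP.*-zeroˡ p) (ℚP.*-monoˡ-<-pos p q<0)
HasSign-*-pos     p zero     refl = ℚP.*-zeroˡ p
HasSign-*-pos {q} p positive 0<q  = subst (ℚ._< q * p) (ℚP.*-zeroˡ p) (ℚP.*-monoˡ-<-pos p 0<q)

sign-*-pos : ∀ q p .{{_ : ℚ.Positive p}} → sign (q * p) ≡ sign q
sign-*-pos q p = sign-unique (sign q) (HasSign-*-pos p (sign q) (sign-correct q))

relSign : Rel → Sign → Bool
relSign eq zero     = true
relSign eq _        = false
relSign lt negative = true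
relSign lt _        = false
relSign gt positive = true
relSign gt _        = false
relSign le positive = false
relSign le _        = true
relSign ge negative = false
relSign ge _        = true

evalRel-HasSign : ∀ r {q} σ → HasSign q σ → evalRel r q ≡ relSign r σ
evalRel-HasSign eq {q} negative q<0  = isYes-false (q ℚP.≟ 0ℚ) (λ q≡0 → ℚP.<-irrefl q≡0 q<0)
evalRel-HasSign le {q} negative q<0  = isYes-true (q ℚP.≤? 0ℚ) (ℚP.<⇒≤ q<0)
evalRel-HasSign lt {q} negative q<0  = isYes-true (q ℚP.<? 0ℚ) q<0
evalRel-HasSign ge {q} negative q<0  = isYes-false (0ℚ ℚP.≤? q) (<⇒≱ q<0)
evalRel-HasSign gt {q} negative q<0  = isYes-false (0ℚ ℚP.<? q) (ℚP.<-asym q<0)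
evalRel-HasSign eq     zero     refl = refl
evalRel-HasSign le     zero     refl = refl
evalRel-HasSign lt     zero     refl = refl
evalRel-HasSign ge     zero     refl = refl
evalRel-HasSign gt     zero     refl = refl
evalRel-HasSign eq {q} positive 0<q  = isYes-false (q ℚP.≟ 0ℚ) (λ q≡0 → ℚP.<-irrefl (sym q≡0) 0<q)
evalRel-HasSign le {q} positive 0<q  = isYes-false (q ℚP.≤? 0ℚ) (<⇒≱ 0<q)
evalRel-HasSign lt {q} positive 0<q  = isYes-false (q ℚP.<? 0ℚ) (ℚP.<-asym 0<q)
evalRel-HasSign ge {q} positive 0<q  = isYes-true (0ℚ ℚP.≤? q) (ℚP.<⇒≤ 0<q)
evalRel-HasSign gt {q} positive 0<q  = isYes-true (0ℚ ℚP.<? q) 0<q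

evalRel-sign : ∀ r q → evalRel r q ≡ relSign r (sign q)
evalRel-sign r q = evalRel-HasSign r (sign q) (sign-correct q)

evalRel-*-pos : ∀ r q p .{{_ : ℚ.Positive p}} → evalRel r (q * p) ≡ evalRel r q
evalRel-*-pos r q p = begin
  evalRel r (q * p)        ≡⟨ evalRel-sign r (q * p) ⟩
  relSign r (sign (q * p)) ≡⟨ cong (relSign r) (sign-*-pos q p) ⟩
  relSign r (sign q)       ≡⟨ evalRel-sign r q ⟨
  evalRel r q              ∎
  where open ≡-Reasoning

-ᵛ_ : ∀ {n} → Vec ℚ n → Vec ℚ n
-ᵛ_ = Vec.map (λ q → - q)

dot-*ʳ : ∀ {n} (a x : Vec ℚ n) p → dot a (Vec.map (_* p) x) ≡ dot a x * p
dot-*ʳ []       []       p = sym (ℚP.*-zeroˡ p)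
dot-*ʳ (a ∷ as) (x ∷ xs) p = begin
  a * (x * p) + dot as (Vec.map (_* p) xs)
    ≡⟨ cong (λ s → a * (x * p) + s) (dot-*ʳ as xs p) ⟩
  a * (x * p) + dot as xs * p
    ≡⟨ solve 4 (λ a x p s → a :* (x :* p) :+ s :* p := (a :* x :+ s) :* p) refl a x p (dot as xs) ⟩
  (a * x + dot as xs) * p
    ∎
  where open ≡-Reasoning

dot-negˡ : ∀ {n} (a y : Vec ℚ n) → dot (-ᵛ a) y ≡ - dot a y
dot-negˡ []       []       = refl
dot-negˡ (a ∷ as) (y ∷ ys) = begin
  - a * y + dot (-ᵛ as) ys ≡⟨ cong (λ s → - a * y + s) (dot-negˡ as ys) ⟩
  - a * y + - dot as ys    ≡⟨ solve 3 (λ a y s → :- a :* y :+ :- s := :- (a :* y :+ s)) refl a y (dot as ys) ⟩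
  - (a * y + dot as ys)    ∎
  where open ≡-Reasoning

dot-zeroˡ : ∀ {n} (y : Vec ℚ n) → dot (Vec.replicate n 0ℚ) y ≡ 0ℚ
dot-zeroˡ []       = refl
dot-zeroˡ (y ∷ ys) = cong₂ _+_ (ℚP.*-zeroˡ y) (dot-zeroˡ ys)

eval-*-pos : ∀ {d} (ψ : Formula d) x k p .{{_ : ℚ.Positive p}} →
             eval ψ (Vec.map (_* p) x) (k * p) ≡ eval ψ x k
eval-*-pos (atom a c r) x k p = begin
  evalRel r (dot a (Vec.map (_* p) x) + c * (k * p))
    ≡⟨ cong (λ v → evalRel r (v + c * (k * p))) (dot-*ʳ a x p) ⟩
  evalRel r (dot a x * p + c * (k * p))
    ≡⟨ cong (evalRel r) (solve 4 (λ v c k p → v :* p :+ c :* (k :* p) := (v :+ c :* k) :* p)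
                               refl (dot a x) c k p) ⟩
  evalRel r ((dot a x + c * k) * p)
    ≡⟨ evalRel-*-pos r (dot a x + c * k) p ⟩
  evalRel r (dot a x + c * k)
    ∎
  where open ≡-Reasoning
eval-*-pos (φ ∧ᶠ ψ) x k p = cong₂ _∧_ (eval-*-pos φ x k p) (eval-*-pos ψ x k p)
eval-*-pos (φ ∨ᶠ ψ) x k p = cong₂ _∨_ (eval-*-pos φ x k p) (eval-*-pos ψ x k p)
eval-*-pos (¬ᶠ φ)   x k p = cong not (eval-*-pos φ x k p)

coprime-1 : ∀ n → Coprimality.Coprime n 1
coprime-1 n = Coprimality.sym (Coprimality.1-coprimeTo n)

-- m + 1 in normal form, so that 1/ (sucℚ m) computes and is visibly positive
sucℚ : ℕ → ℚ
sucℚ m = mkℚ (+ suc m) 0 (coprime-1 (suc m))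

natℚ-suc : ∀ m → natℚ (suc m) ≡ sucℚ m
natℚ-suc m = ℚP.↥p/↧p≡p (sucℚ m)

i/1≡mkℚ : ∀ i → i ℚ./ 1 ≡ mkℚ i 0 (coprime-1 ℤ.∣ i ∣)
i/1≡mkℚ i = ℚP.↥p/↧p≡p (mkℚ i 0 (coprime-1 ℤ.∣ i ∣))

i/suc≡i/1*1/suc : ∀ i m → i ℚ./ suc m ≡ (i ℚ./ 1) * 1/ sucℚ m
i/suc≡i/1*1/suc i m = begin
  i ℚ./ suc m                             ≡⟨ ℚP./-cong (ℤP.*-identityʳ i) (ℕP.*-identityˡ (suc m)) ⟨
  (i ℤ.* + 1) ℚ./ (1 ℕ.* suc m)           ≡⟨⟩
  mkℚ i 0 (coprime-1 ℤ.∣ i ∣) * 1/ sucℚ m ≡⟨ cong (_* 1/ sucℚ m) (i/1≡mkℚ i) ⟨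
  (i ℚ./ 1) * 1/ sucℚ m                   ∎
  where open ≡-Reasoning

scaleDown≡map-* : ∀ {d} m (z : Vec ℤ d) → scaleDown m z ≡ Vec.map (_* 1/ sucℚ m) (toℚ z)
scaleDown≡map-* m z = begin
  Vec.map (ℚ._/ suc m) z                  ≡⟨ VecP.map-cong (λ i → i/suc≡i/1*1/suc i m) z ⟩
  Vec.map (λ i → (i ℚ./ 1) * 1/ sucℚ m) z ≡⟨ VecP.map-∘ (_* 1/ sucℚ m) (ℚ._/ 1) z ⟩
  Vec.map (_* 1/ sucℚ m) (toℚ z)          ∎
  where open ≡-Reasoning

eval-scaleDown : ∀ {d} (ψ : Formula d) m z →
                 eval ψ (scaleDown m z) 1ℚ ≡ eval ψ (toℚ z) (natℚ (suc m))
eval-scaleDown ψ m z = begin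
  eval ψ (scaleDown m z) 1ℚ
    ≡⟨ cong₂ (eval ψ) (scaleDown≡map-* m z) (sym (ℚP.*-inverseʳ (sucℚ m))) ⟩
  eval ψ (Vec.map (_* 1/ sucℚ m) (toℚ z)) (sucℚ m * 1/ sucℚ m)
    ≡⟨ eval-*-pos ψ (toℚ z) (sucℚ m) (1/ sucℚ m) ⟩
  eval ψ (toℚ z) (sucℚ m)
    ≡⟨ cong (eval ψ (toℚ z)) (natℚ-suc m) ⟨
  eval ψ (toℚ z) (natℚ (suc m))
    ∎
  where open ≡-Reasoning

module _ {d : ℕ} where

  Sat : List (Ineq d) → Vec ℚ d → Set
  Sat sys y = All (λ I → T (satIneq I y)) sys

  memSystem⇒Sat : ∀ sys y → T (memSystem sys y) → Sat sys y
  memSystem⇒Sat sys y = AllP.all⁺ (λ I → satIneq I y) sys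

  Sat⇒memSystem : ∀ sys y → Sat sys y → T (memSystem sys y)
  Sat⇒memSystem sys y = AllP.all⁻ (λ I → satIneq I y)

  slack : Vec ℚ d → ℚ → Vec ℚ d → ℚ
  slack a b y = dot a y - b

  slack-neg : ∀ a b y → slack (-ᵛ a) (- b) y ≡ - slack a b y
  slack-neg a b y = begin
    dot (-ᵛ a) y - - b ≡⟨ cong (_- - b) (dot-negˡ a y) ⟩
    - dot a y - - b    ≡⟨ solve 2 (λ v b → :- v :- :- b := :- (v :- b)) refl (dot a y) b ⟩
    - (dot a y - b)    ∎
    where open ≡-Reasoning

  strict⇒0<slack : ∀ a b y → T (satIneq (ineq a b true) y) → 0ℚ ℚ.< slack a b y
  strict⇒0<slack a b y = p<q⇒0<q-p ∘ toWitness

  0<slack⇒strict : ∀ a b y → 0ℚ ℚ.< slack a b y → T (satIneq (ineq a b true) y)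
  0<slack⇒strict a b y = fromWitness ∘ 0<q-p⇒p<q

  weak⇒0≤slack : ∀ a b y → T (satIneq (ineq a b false) y) → 0ℚ ℚ.≤ slack a b y
  weak⇒0≤slack a b y = p≤q⇒0≤q-p ∘ toWitness

  0≤slack⇒weak : ∀ a b y → 0ℚ ℚ.≤ slack a b y → T (satIneq (ineq a b false) y)
  0≤slack⇒weak a b y = fromWitness ∘ 0≤q-p⇒p≤q

  signCell : Vec ℚ d → ℚ → Sign → List (Ineq d)
  signCell a b negative = ineq (-ᵛ a) (- b) true ∷ []
  signCell a b zero     = ineq a b false ∷ ineq (-ᵛ a) (- b) false ∷ []
  signCell a b positive = ineq a b true ∷ []

  signCell-sound : ∀ a b σ y → Sat (signCell a b σ) y → HasSign (slack a b y) σ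
  signCell-sound a b negative y (h ∷ []) =
    0<-p⇒p<0 (subst (0ℚ ℚ.<_) (slack-neg a b y) (strict⇒0<slack (-ᵛ a) (- b) y h))
  signCell-sound a b zero y (h ∷ h′ ∷ []) =
    ℚP.≤-antisym (0≤-p⇒p≤0 (subst (0ℚ ℚ.≤_) (slack-neg a b y) (weak⇒0≤slack (-ᵛ a) (- b) y h′)))
                 (weak⇒0≤slack a b y h)
  signCell-sound a b positive y (h ∷ []) = strict⇒0<slack a b y h

  signCell-complete : ∀ a b σ y → HasSign (slack a b y) σ → Sat (signCell a b σ) y
  signCell-complete a b negative y s<0 =
    0<slack⇒strict (-ᵛ a) (- b) y (subst (0ℚ ℚ.<_) (sym (slack-neg a b y)) (ℚP.neg-antimono-< s<0)) ∷ []
  signCell-complete a b zero y s≡0 =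
    0≤slack⇒weak a b y (ℚP.≤-reflexive (sym s≡0)) ∷
    0≤slack⇒weak (-ᵛ a) (- b) y (ℚP.≤-reflexive (sym (trans (slack-neg a b y) (cong (λ q → - q) s≡0)))) ∷ []
  signCell-complete a b positive y 0<s = 0<slack⇒strict a b y 0<s ∷ []

  Signs : Formula d → Set
  Signs (atom _ _ _) = Sign
  Signs (φ ∧ᶠ ψ)     = Signs φ × Signs ψ
  Signs (φ ∨ᶠ ψ)     = Signs φ × Signs ψ
  Signs (¬ᶠ φ)       = Signs φ

  atom-slack : ∀ a c y → dot a y + c * 1ℚ ≡ slack a (- c) y
  atom-slack a c y = solve 2 (λ v c → v :+ c :* con 1ℚ := v :- :- c) refl (dot a y) c

  signsAt : (ψ : Formula d) → Vec ℚ d → Signs ψ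
  signsAt (atom a c _) y = sign (slack a (- c) y)
  signsAt (φ ∧ᶠ ψ)     y = signsAt φ y , signsAt ψ y
  signsAt (φ ∨ᶠ ψ)     y = signsAt φ y , signsAt ψ y
  signsAt (¬ᶠ φ)       y = signsAt φ y

  evalSigns : (ψ : Formula d) → Signs ψ → Bool
  evalSigns (atom _ _ r) σ       = relSign r σ
  evalSigns (φ ∧ᶠ ψ)     (s , t) = evalSigns φ s ∧ evalSigns ψ t
  evalSigns (φ ∨ᶠ ψ)     (s , t) = evalSigns φ s ∨ evalSigns ψ t
  evalSigns (¬ᶠ φ)       s       = not (evalSigns φ s)

  evalSigns-signsAt : ∀ ψ y → evalSigns ψ (signsAt ψ y) ≡ eval ψ y 1ℚ
  evalSigns-signsAt (atom a c r) y = begin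
    relSign r (sign (slack a (- c) y)) ≡⟨ evalRel-sign r (slack a (- c) y) ⟨
    evalRel r (slack a (- c) y)        ≡⟨ cong (evalRel r) (atom-slack a c y) ⟨
    evalRel r (dot a y + c * 1ℚ)       ∎
    where open ≡-Reasoning
  evalSigns-signsAt (φ ∧ᶠ ψ) y = cong₂ _∧_ (evalSigns-signsAt φ y) (evalSigns-signsAt ψ y)
  evalSigns-signsAt (φ ∨ᶠ ψ) y = cong₂ _∨_ (evalSigns-signsAt φ y) (evalSigns-signsAt ψ y)
  evalSigns-signsAt (¬ᶠ φ)   y = cong not (evalSigns-signsAt φ y)

  cell : (ψ : Formula d) → Signs ψ → List (Ineq d)
  cell (atom a c _) σ       = signCell a (- c) σ
  cell (φ ∧ᶠ ψ)     (s , t) = cell φ s ++ cell ψ t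
  cell (φ ∨ᶠ ψ)     (s , t) = cell φ s ++ cell ψ t
  cell (¬ᶠ φ)       s       = cell φ s

  cell-sound : ∀ ψ s y → Sat (cell ψ s) y → signsAt ψ y ≡ s
  cell-sound (atom a c _) σ y h = sign-unique σ (signCell-sound a (- c) σ y h)
  cell-sound (φ ∧ᶠ ψ) (s , t) y h =
    let hφ , hψ = AllP.++⁻ (cell φ s) h in cong₂ _,_ (cell-sound φ s y hφ) (cell-sound ψ t y hψ)
  cell-sound (φ ∨ᶠ ψ) (s , t) y h =
    let hφ , hψ = AllP.++⁻ (cell φ s) h in cong₂ _,_ (cell-sound φ s y hφ) (cell-sound ψ t y hψ)
  cell-sound (¬ᶠ φ) s y h = cell-sound φ s y h

  cell-complete : ∀ ψ y → Sat (cell ψ (signsAt ψ y)) y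
  cell-complete (atom a c _) y = signCell-complete a (- c) _ y (sign-correct (slack a (- c) y))
  cell-complete (φ ∧ᶠ ψ)     y = AllP.++⁺ (cell-complete φ y) (cell-complete ψ y)
  cell-complete (φ ∨ᶠ ψ)     y = AllP.++⁺ (cell-complete φ y) (cell-complete ψ y)
  cell-complete (¬ᶠ φ)       y = cell-complete φ y

  allSigns : (ψ : Formula d) → List (Signs ψ)
  allSigns (atom _ _ _) = negative ∷ zero ∷ positive ∷ []
  allSigns (φ ∧ᶠ ψ)     = List.cartesianProduct (allSigns φ) (allSigns ψ)
  allSigns (φ ∨ᶠ ψ)     = List.cartesianProduct (allSigns φ) (allSigns ψ)
  allSigns (¬ᶠ φ)       = allSigns φ

  allSigns-complete : ∀ ψ s → s ∈ allSigns ψ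
  allSigns-complete (atom _ _ _) negative = here refl
  allSigns-complete (atom _ _ _) zero     = there (here refl)
  allSigns-complete (atom _ _ _) positive = there (there (here refl))
  allSigns-complete (φ ∧ᶠ ψ) (s , t) =
    ∈-cartesianProduct⁺ (allSigns-complete φ s) (allSigns-complete ψ t)
  allSigns-complete (φ ∨ᶠ ψ) (s , t) =
    ∈-cartesianProduct⁺ (allSigns-complete φ s) (allSigns-complete ψ t)
  allSigns-complete (¬ᶠ φ) s = allSigns-complete φ s

  allSigns-unique : ∀ ψ → Unique (allSigns ψ)
  allSigns-unique (atom _ _ _) =
    ((λ ()) ∷ (λ ()) ∷ []) AllPairs.∷ ((λ ()) ∷ []) AllPairs.∷ [] AllPairs.∷ AllPairs.[]
  allSigns-unique (φ ∧ᶠ ψ) = UniqueP.cartesianProduct⁺ (allSigns-unique φ) (allSigns-unique ψ)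
  allSigns-unique (φ ∨ᶠ ψ) = UniqueP.cartesianProduct⁺ (allSigns-unique φ) (allSigns-unique ψ)
  allSigns-unique (¬ᶠ φ)   = allSigns-unique φ

  infeasible : Ineq d
  infeasible = ineq (Vec.replicate d 0ℚ) 0ℚ true

  infeasible-unsat : ∀ y → ¬ T (satIneq infeasible y)
  infeasible-unsat y h = ℚP.<-irrefl (sym (dot-zeroˡ y)) (toWitness h)

  acceptIf : Bool → List (Ineq d)
  acceptIf true  = []
  acceptIf false = infeasible ∷ []

  Sat-acceptIf : ∀ b y → Sat (acceptIf b) y → T b
  Sat-acceptIf true  y _        = tt
  Sat-acceptIf false y (h ∷ []) = ⊥-elim (infeasible-unsat y h)

  acceptIf-Sat : ∀ {b} y → T b → Sat (acceptIf b) y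
  acceptIf-Sat {true} y _ = []

module Complex {d : ℕ} (ψ : Formula d) (ψ-bounded : Bounded (λ y → eval ψ y 1ℚ)) where

  -- a sign vector rejected by ψ contributes an empty piece
  pieceSystem : Signs ψ → List (Ineq d)
  pieceSystem s = acceptIf (evalSigns ψ s) ++ cell ψ s

  pieceSystem-signsAt : ∀ s y → Sat (pieceSystem s) y → signsAt ψ y ≡ s
  pieceSystem-signsAt s y h = cell-sound ψ s y (AllP.++⁻ʳ (acceptIf (evalSigns ψ s)) h)

  pieceSystem-sound : ∀ s y → Sat (pieceSystem s) y → T (eval ψ y 1ℚ)
  pieceSystem-sound s y h =
    subst T accepted (Sat-acceptIf _ y (AllP.++⁻ˡ (acceptIf (evalSigns ψ s)) h))
    where
    accepted : evalSigns ψ s ≡ eval ψ y 1ℚ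
    accepted = trans (cong (evalSigns ψ) (sym (pieceSystem-signsAt s y h))) (evalSigns-signsAt ψ y)

  pieceSystem-complete : ∀ y → T (eval ψ y 1ℚ) → Sat (pieceSystem (signsAt ψ y)) y
  pieceSystem-complete y h =
    AllP.++⁺ (acceptIf-Sat y (subst T (sym (evalSigns-signsAt ψ y)) h)) (cell-complete ψ y)

  piece : Signs ψ → HalfOpenPolytope d
  piece s = hop (pieceSystem s)
    (proj₁ ψ-bounded , λ y h → proj₂ ψ-bounded y (pieceSystem-sound s y (memSystem⇒Sat _ y h)))

  piece-disjoint : ∀ {s t} → s ≢ t → Disjoint (piece s) (piece t)
  piece-disjoint {s} {t} s≢t y hs ht =
    s≢t (trans (sym (pieceSystem-signsAt s y (memSystem⇒Sat _ y hs)))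
               (pieceSystem-signsAt t y (memSystem⇒Sat _ y ht)))

  complex : PartialPolytopalComplex d
  complex = ppc (List.map piece (allSigns ψ))
                (AllPairsP.map⁺ (AllPairs.map piece-disjoint (allSigns-unique ψ)))

  memPPC-complex : ∀ y → memPPC complex y ≡ eval ψ y 1ℚ
  memPPC-complex y = T-injective sound complete
    where
    inPiece : HalfOpenPolytope d → Bool
    inPiece P = memHOP P y

    sound : T (memPPC complex y) → T (eval ψ y 1ℚ)
    sound h =
      let s , hs = Any.satisfied (AnyP.map⁻ (AnyP.any⁻ inPiece (List.map piece (allSigns ψ)) h))
      in pieceSystem-sound s y (memSystem⇒Sat _ y hs)

    complete : T (eval ψ y 1ℚ) → T (memPPC complex y)
    complete h = AnyP.any⁺ inPiece (AnyP.map⁺ {f = piece}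
      (lose (allSigns-complete ψ (signsAt ψ y)) (Sat⇒memSystem _ y (pieceSystem-complete y h))))

  memDilate-complex : ∀ m z → memDilate complex m z ≡ eval ψ (toℚ z) (natℚ (suc m))
  memDilate-complex m z = trans (memPPC-complex (scaleDown m z)) (eval-scaleDown ψ m z)

countTrue-cong : ∀ {A : Set} {f g : A → Bool} → (∀ a → f a ≡ g a) →
                 ∀ xs → countTrue f xs ≡ countTrue g xs
countTrue-cong f≡g []       = refl
countTrue-cong f≡g (a ∷ xs) =
  cong₂ ℕ._+_ (cong (λ b → if b then 1 else 0) (f≡g a)) (countTrue-cong f≡g xs)

HasCount-cong : ∀ {d} {S S′ : Vec ℤ d → Bool} {n} →
                (∀ z → S z ≡ S′ z) → HasCount S n → HasCount S′ n
HasCount-cong {d} S≡S′ (N , inBox , count) =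
  N , (λ z h → inBox z (subst T (sym (S≡S′ z)) h)) , trans (sym (countTrue-cong S≡S′ (box N d))) count

n/1≤p⇒n≤∣↥p∣ : ∀ n p → mkℚ (+ n) 0 (coprime-1 n) ℚ.≤ p → n ℕ.≤ ℤ.∣ ℚ.↥ p ∣
n/1≤p⇒n≤∣↥p∣ n (mkℚ (+ k) e _) (ℚ.*≤* n*e≤k*1) = begin
  n           ≤⟨ ℕP.m≤m*n n (suc e) ⟩
  n ℕ.* suc e ≤⟨ ℤP.drop‿+≤+ (subst₂ ℤ._≤_ (sym (ℤP.pos-* n (suc e))) (sym (ℤP.pos-* k 1)) n*e≤k*1) ⟩
  k ℕ.* 1     ≡⟨ ℕP.*-identityʳ k ⟩
  k           ∎
  where open ℕP.≤-Reasoning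
n/1≤p⇒n≤∣↥p∣ n p@(mkℚ -[1+ _ ] _ _) n≤p =
  ⊥-elim (ℚP.<-irrefl refl (ℚP.≤-<-trans (ℚP.≤-trans (ℚP.nonNegative⁻¹ _) n≤p) (ℚP.negative⁻¹ p)))

∣i/1∣≤p⇒∣i∣≤∣↥p∣ : ∀ i p → ℚ.∣ i ℚ./ 1 ∣ ℚ.≤ p → ℤ.∣ i ∣ ℕ.≤ ℤ.∣ ℚ.↥ p ∣
∣i/1∣≤p⇒∣i∣≤∣↥p∣ i p h = n/1≤p⇒n≤∣↥p∣ ℤ.∣ i ∣ p (subst (λ q → ℚ.∣ q ∣ ℚ.≤ p) (i/1≡mkℚ i) h)

bounded⇒HasCount : ∀ {d} (S : Vec ℚ d → Bool) → Bounded S → Σ ℕ (HasCount (S ∘ toℚ))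
bounded⇒HasCount {d} S (M , bound) = countTrue (S ∘ toℚ) (box N d) , N , inBox , refl
  where
  N : ℕ
  N = ℤ.∣ ℚ.↥ M ∣

  inBox : ∀ z → T (S (toℚ z)) → InBox N z
  inBox z h = VecAllP.lookup⁻ λ i → ∣i/1∣≤p⇒∣i∣≤∣↥p∣ (Vec.lookup z i) M
    (subst (λ q → ℚ.∣ q ∣ ℚ.≤ M) (VecP.lookup-map i (ℚ._/ 1) z) (bound (toℚ z) h i))

lemma1 : (d : ℕ) → 1 ≤ d → (ψ : Formula d) →
    (∀ (k : ℚ) → Bounded (λ x → eval ψ x k)) →
    Σ (PartialPolytopalComplex d) λ X →
      ∀ (m : ℕ) → Σ ℕ λ n →
        HasCount (λ z → eval ψ (toℚ z) (natℚ (suc m))) n × EhrEq X m n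
lemma1 d _ ψ bounded = complex , λ m →
  let n , count = bounded⇒HasCount (λ x → eval ψ x (natℚ (suc m))) (bounded (natℚ (suc m)))
  in n , count , HasCount-cong (λ z → sym (memDilate-complex m z)) count
  where open Complex ψ (bounded 1ℚ)
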